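{- Let $(G,A)$ be a simple edge-weighted graph on vertices $v_1,\dots,v_n$, and let $(G',A')$ be the result of a finite sequence of collapsing operations on $(G,A)$ which removes the vertices $v_{r+1},\dots,v_n$ (each by one star-clique operation, applied only when the current graph has no multiple edges) and collapses any multiple edges, so that $G'$ has vertices $v_1,\dots,v_r$. Then the map $\phi:S_G\to S_{G'}$, $\phi(g_1,\dots,g_n)=(g_1,\dots,g_r)$, is a surjective $\mathbb{Z}$-module homomorphism with kernel $\mathcal{F}_r\cup\cdots\cup\mathcal{F}_{n-1}\cup\mathcal{F}_n$.
   Context: An edge-weighted graph $(G,A)$ is a finite loopless graph (multiple edges allowed unless "simple" is stated) with a weight function $A$ from its edges to positive integers. A spline on $(G,A)$ with vertices $v_1,\dots,v_n$ is $(g_1,\dots,g_n)\in\mathbb{Z}^n$ with $g_i\equiv g_j\pmod{A(e)}$ for every edge $e$ joining $v_i$ and $v_j$; $S_G$ is the $\mathbb{Z}$-module of splines. Collapsing operations: (a) star-clique on a vertex $v$ (of a graph without multiple edges) with neighbours $w_1,\dots,w_d$ and edge $vw_k$ of weight $a_k$: delete $v$ and its incident edges and, for each pair $j<k$, add a new edge between $w_j$ and $w_k$ of weight $\gcd(a_j,a_k)$ (possibly creating multiple edges); (b) edge collapse: replace edges $e_1,\dots,e_r$ ($r\ge2$) joining the same pair of vertices, of weights $a_1,\dots,a_r$, by one edge of weight $\operatorname{lcm}(a_1,\dots,a_r)$. Flow-up classes of $S_G$: for $0\le i<n$, $\mathcal{F}_i$ is the set of splines with $g_1=\cdots=g_i=0$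 and $g_{i+1}\ne0$; $\mathcal{F}_n=\{0\}$. -}

module Defs where

open import Data.Nat using (ℕ; zero; suc; _+_; _<_; _≤_; _<ᵇ_)
open import Data.Nat.GCD using (gcd)
open import Data.Nat.LCM using (lcm)
open import Data.Integer using (ℤ; +_; _-_)
open import Data.Integer.Divisibility using () renaming (_∣_ to _∣ℤ_)
open import Data.Fin using (Fin; toℕ; _↑ˡ_; _≟_)
open import Data.List using (List; []; _∷_; _++_; map; filterᵇ; foldr; length)
open import Data.List.Relation.Unary.All using (All)
open import Data.List.Relation.Unary.AllPairs using (AllPairs)
open import Data.List.Relation.Binary.Permutation.Propositional using (_↭_)
open import Data.Product using (_×_; _,_; proj₁; proj₂; ∃)
open import Data.Sum using (_⊎_)
open import Data.Bool using (Bool; true; false; not; _∨_; if_then_else_)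
open import Relation.Binary.PropositionalEquality using (_≡_; _≢_)
open import Relation.Nullary using (¬_)
open import Relation.Nullary.Decidable using (⌊_⌋)
open import Relation.Binary.Construct.Closure.ReflexiveTransitive using (Star)

-- An edge of a graph on vertices Fin N: (endpoint, endpoint, weight).
-- A (multi)graph is a list of edges (multiple edges = several list entries).
Edge : ℕ → Set
Edge N = Fin N × Fin N × ℕ

src : ∀ {N} → Edge N → Fin N
src (u , _ , _) = u

tgt : ∀ {N} → Edge N → Fin N
tgt (_ , v , _) = v

wt : ∀ {N} → Edge N → ℕ
wt (_ , _ , a) = a

Joins : ∀ {N} → Fin N → Fin N → Edge N → Set
Joins u v e = (src e ≡ u × tgt e ≡ v) ⊎ (src e ≡ v × tgt e ≡ u)

SamePair : ∀ {N} → Edge N → Edge N → Set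
SamePair e f = Joins (src e) (tgt e) f

NoMultiple : ∀ {N} → List (Edge N) → Set
NoMultiple = AllPairs (λ e f → ¬ SamePair e f)

Loopless : ∀ {N} → List (Edge N) → Set
Loopless = All (λ e → src e ≢ tgt e)

PositiveWeights : ∀ {N} → List (Edge N) → Set
PositiveWeights = All (λ e → 0 < wt e)

SimpleWeighted : ∀ {N} → List (Edge N) → Set
SimpleWeighted es = Loopless es × PositiveWeights es × NoMultiple es

-- Intermediate graphs of the collapsing process: the set of still-present
-- vertices (as a predicate on Fin N) together with the current edges.
record State (N : ℕ) : Set where
  constructor ⟨_,_⟩
  field
    alive : Fin N → Bool
    edges : List (Edge N)
open State public

incidentᵇ : ∀ {N} → Fin N → Edge N → Bool
incidentᵇ v e = ⌊ src e ≟ v ⌋ ∨ ⌊ tgt e ≟ v ⌋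

other : ∀ {N} → Fin N → Edge N → Fin N
other v e = if ⌊ src e ≟ v ⌋ then tgt e else src e

clique : ∀ {N} → Fin N → List (Edge N) → List (Edge N)
clique v [] = []
clique v (e ∷ es) =
  map (λ f → (other v e , other v f , gcd (wt e) (wt f))) es ++ clique v es

starClique : ∀ {N} → State N → Fin N → State N
starClique ⟨ al , es ⟩ v =
  ⟨ (λ u → if ⌊ u ≟ v ⌋ then false else al u)
  , filterᵇ (λ e → not (incidentᵇ v e)) es ++ clique v (filterᵇ (incidentᵇ v) es) ⟩

lcmList : ∀ {N} → List (Edge N) → ℕ
lcmList = foldr (λ e l → lcm (wt e) l) 1

data Step {N : ℕ} : State N → State N → Set where
  star : ∀ (s : State N) (v : Fin N) → alive s v ≡ true → NoMultiple (edges s) →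
         Step s (starClique s v)
  collapse : ∀ (al : Fin N → Bool) (es es₁ rest : List (Edge N)) (u w : Fin N) →
             es ↭ es₁ ++ rest → 2 ≤ length es₁ → All (Joins u w) es₁ →
             Step ⟨ al , es ⟩ ⟨ al , (u , w , lcmList es₁) ∷ rest ⟩

Steps : ∀ {N} → State N → State N → Set
Steps = Star Step

IsSpline : ∀ {N} → List (Edge N) → (Fin N → ℤ) → Set
IsSpline es g = All (λ e → (+ wt e) ∣ℤ (g (src e) - g (tgt e))) es

-- splines on the collapsed graph G', whose vertices are v_1..v_r, i.e. the
-- vertices i ↑ˡ k (i : Fin r) of Fin (r + k)
IsSpline' : ∀ r k → List (Edge (r + k)) → (Fin r → ℤ) → Set
IsSpline' r k es h =
  All (λ e → ∀ (i j : Fin r) → i ↑ˡ k ≡ src e → j ↑ˡ k ≡ tgt e →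
             (+ wt e) ∣ℤ (h i - h j)) es

φ : ∀ r k → (Fin (r + k) → ℤ) → (Fin r → ℤ)
φ r k g i = g (i ↑ˡ k)

-- flow-up class F_m of S_G (vertex v_{i+1} is the vertex i : Fin N)
InFlowUp : ∀ {N} → List (Edge N) → ℕ → (Fin N → ℤ) → Set
InFlowUp {N} es m g =
  IsSpline es g ×
  ((m < N × (∀ (j : Fin N) → toℕ j < m → g j ≡ + 0) × ∃ (λ (j : Fin N) → toℕ j ≡ m × g j ≢ + 0))
   ⊎ (m ≡ N × ∀ (j : Fin N) → g j ≡ + 0))

-- Every collapsing operation maps splines to splines: an edge collapse because
-- congruences modulo a₁, …, aᵣ combine into one modulo their lcm, a star-clique
-- because g(w_j) ≡ g(v) ≡ g(w_k) modulo gcd(a_j, a_k).  Conversely every spline of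
-- the collapsed graph lifts back along each operation: an edge collapse changes
-- nothing, and for a star-clique the clique edges say precisely that the
-- congruences x ≡ g(w_k) (mod a_k) are pairwise compatible, so the generalised
-- Chinese remainder theorem (which rests on gcd(a, lcm(b, c)) ∣ lcm(gcd(a, b), gcd(a, c)))
-- provides a value x at v.  Lifting a spline of G′ extended by zero gives
-- surjectivity, because every edge of every intermediate graph joins two distinct
-- surviving vertices: G has no loops, and a star-clique on a vertex without
-- multiple edges creates none.  Finally, a spline vanishing on v₁, …, v_r has its
-- first non-zero entry, if any, at an index ≥ r, so it lies in some F_m with m ≥ r.

module Submission where

open import Defs

open import Data.Nat as ℕ using (ℕ; ≢-nonZero)
import Data.Nat.Properties as ℕ
open import Data.Nat.Divisibility
  using (_∣_; ∣-trans; *-pres-∣; *-monoʳ-∣; *-cancelˡ-∣; _∣0; 1∣_; module ∣-Reasoning)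
open import Data.Nat.GCD
  using (gcd; gcd[m,n]∣m; gcd[m,n]∣n; gcd-greatest; gcd[m,n]≡0⇒m≡0; gcd-zeroʳ;
         c*gcd[m,n]≡gcd[cm,cn]; gcd-GCD; module Bézout)
open import Data.Nat.LCM using (lcm; m∣lcm[m,n]; n∣lcm[m,n]; lcm-least; gcd*lcm)
open import Data.Bool using (Bool; true; false; not; T)
open import Data.Fin using (Fin; _≟_)
open import Data.Product using (_×_; _,_; ∃; ∃₂)
open import Data.Sum using (inj₁; inj₂)
open import Data.List using (List; []; _∷_; foldr; filterᵇ; map)
open import Data.List.Relation.Unary.All as All using (All; []; _∷_)
import Data.List.Relation.Unary.All.Properties as AllP
open import Data.List.Relation.Unary.AllPairs as AllPairs using (AllPairs; []; _∷_)
import Data.List.Relation.Unary.AllPairs.Properties as AllPairsP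
open import Data.List.Relation.Binary.Permutation.Propositional using (↭-sym)
open import Data.List.Relation.Binary.Permutation.Propositional.Properties using (All-resp-↭)
open import Data.Vec.Functional using (updateAt)
open import Data.Vec.Functional.Properties using (updateAt-updates; updateAt-minimal)
open import Function using (_∘_; const; id)
open import Relation.Binary.Construct.Closure.ReflexiveTransitive using (ε; _◅_)
open import Relation.Binary.PropositionalEquality
open import Relation.Nullary using (¬_; yes; no; contradiction)
open import Relation.Nullary.Decidable using (T?)

All⇒AllPairs : ∀ {a p r} {A : Set a} {P : A → Set p} {R : A → A → Set r} →
               (∀ {x y} → P x → P y → R x y) → ∀ {xs} → All P xs → AllPairs R xs
All⇒AllPairs f []         = []
All⇒AllPairs f (px ∷ pxs) = All.map (f px) pxs ∷ All⇒AllPairs f pxs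

-- AllP.filter⁻ is stated for filter (¬? ∘ P?), which does not reduce to filterᵇ (not ∘ p).
filterᵇ⁻ : ∀ {a q} {A : Set a} {Q : A → Set q} (p : A → Bool) xs →
           All Q (filterᵇ p xs) → All Q (filterᵇ (not ∘ p) xs) → All Q xs
filterᵇ⁻ p []       _          _          = []
filterᵇ⁻ p (x ∷ xs) qs         rs         with p x
filterᵇ⁻ p (x ∷ xs) (q ∷ qs)   rs         | true  = q ∷ filterᵇ⁻ p xs qs rs
filterᵇ⁻ p (x ∷ xs) qs         (r ∷ rs)   | false = r ∷ filterᵇ⁻ p xs qs rs

module _ {d b c : ℕ} where
  open ∣-Reasoning
  open import Data.Nat using (_*_)

  private
    e = gcd d b
    f = gcd d c
    h = gcd e f

  d*gcd∣gcd*gcd : d ∣ lcm b c → d * gcd (gcd d b) (gcd d c) ∣ gcd d b * gcd d c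
  d*gcd∣gcd*gcd d∣lcm = begin
    d * h                ∣⟨ gcd-greatest dh∣e*d dh∣e*c ⟩
    gcd (e * d) (e * c)  ≡⟨ c*gcd[m,n]≡gcd[cm,cn] e d c ⟨
    e * f                ∎
    where
    h∣b : h ∣ b
    h∣b = ∣-trans (gcd[m,n]∣m e f) (gcd[m,n]∣n d b)
    h∣c : h ∣ c
    h∣c = ∣-trans (gcd[m,n]∣n e f) (gcd[m,n]∣n d c)
    dh∣e*d : d * h ∣ e * d
    dh∣e*d = begin
      d * h  ∣⟨ *-monoʳ-∣ d (gcd[m,n]∣m e f) ⟩
      d * e  ≡⟨ ℕ.*-comm d e ⟩
      e * d  ∎
    dh∣c*d : d * h ∣ c * d
    dh∣c*d = begin
      d * h  ∣⟨ *-monoʳ-∣ d h∣c ⟩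
      d * c  ≡⟨ ℕ.*-comm d c ⟩
      c * d  ∎
    dh∣c*b : d * h ∣ c * b
    dh∣c*b = begin
      d * h              ∣⟨ *-pres-∣ d∣lcm (gcd-greatest h∣b h∣c) ⟩
      lcm b c * gcd b c  ≡⟨ ℕ.*-comm (lcm b c) (gcd b c) ⟩
      gcd b c * lcm b c  ≡⟨ gcd*lcm b c ⟩
      b * c              ≡⟨ ℕ.*-comm b c ⟩
      c * b              ∎
    dh∣e*c : d * h ∣ e * c
    dh∣e*c = begin
      d * h                ∣⟨ gcd-greatest dh∣c*d dh∣c*b ⟩
      gcd (c * d) (c * b)  ≡⟨ c*gcd[m,n]≡gcd[cm,cn] c d b ⟨
      c * e                ≡⟨ ℕ.*-comm c e ⟩
      e * c                ∎

  ∣lcm⇒∣lcm[gcd,gcd] : d ∣ lcm b c → d ∣ lcm (gcd d b) (gcd d c)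
  ∣lcm⇒∣lcm[gcd,gcd] d∣lcm with h ℕ.≟ 0
  ... | yes h≡0 = subst (_∣ lcm e f) (trans e≡0 (sym d≡0)) (m∣lcm[m,n] e f)
    where
    e≡0 : e ≡ 0
    e≡0 = gcd[m,n]≡0⇒m≡0 h≡0
    d≡0 : d ≡ 0
    d≡0 = gcd[m,n]≡0⇒m≡0 e≡0
  ... | no h≢0 = *-cancelˡ-∣ h {{≢-nonZero h≢0}} (begin
    h * d        ≡⟨ ℕ.*-comm h d ⟩
    d * h        ∣⟨ d*gcd∣gcd*gcd d∣lcm ⟩
    e * f        ≡⟨ gcd*lcm e f ⟨
    h * lcm e f  ∎)

gcd[a,lcm[b,c]]∣lcm[gcd[a,b],gcd[a,c]] : ∀ a b c → gcd a (lcm b c) ∣ lcm (gcd a b) (gcd a c)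
gcd[a,lcm[b,c]]∣lcm[gcd[a,b],gcd[a,c]] a b c =
  ∣-trans (∣lcm⇒∣lcm[gcd,gcd] (gcd[m,n]∣n a (lcm b c)))
          (lcm-least (∣-trans (gcd[d,x]∣gcd[a,x] b) (m∣lcm[m,n] (gcd a b) (gcd a c)))
                     (∣-trans (gcd[d,x]∣gcd[a,x] c) (n∣lcm[m,n] (gcd a b) (gcd a c))))
  where
  d = gcd a (lcm b c)
  gcd[d,x]∣gcd[a,x] : ∀ x → gcd d x ∣ gcd a x
  gcd[d,x]∣gcd[a,x] x = gcd-greatest (∣-trans (gcd[m,n]∣m d x) (gcd[m,n]∣m a (lcm b c))) (gcd[m,n]∣n d x)

module _ {ℓ} {A : Set ℓ} (m : A → ℕ) where

  -- Defs.lcmList is definitionally lcmOf wt.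
  lcmOf : List A → ℕ
  lcmOf = foldr (λ x l → lcm (m x) l) 1

  m∣lcmOf : ∀ xs → All (λ x → m x ∣ lcmOf xs) xs
  m∣lcmOf []       = []
  m∣lcmOf (x ∷ xs) = m∣lcm[m,n] (m x) (lcmOf xs)
    ∷ All.map (λ my∣ → ∣-trans my∣ (n∣lcm[m,n] (m x) (lcmOf xs))) (m∣lcmOf xs)

  lcmOf-least : ∀ {n} xs → All (λ x → m x ∣ n) xs → lcmOf xs ∣ n
  lcmOf-least {n} []       []       = 1∣ n
  lcmOf-least     (x ∷ xs) (p ∷ ps) = lcm-least p (lcmOf-least xs ps)

  gcd-lcmOf-least : ∀ a {n} xs → All (λ x → gcd a (m x) ∣ n) xs → gcd a (lcmOf xs) ∣ n
  gcd-lcmOf-least a {n} []       []       = subst (_∣ n) (sym (gcd-zeroʳ a)) (1∣ n)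
  gcd-lcmOf-least a     (x ∷ xs) (p ∷ ps) =
    ∣-trans (gcd[a,lcm[b,c]]∣lcm[gcd[a,b],gcd[a,c]] a (m x) (lcmOf xs))
            (lcm-least p (gcd-lcmOf-least a xs ps))

module Congruence where

  open import Data.Integer using (ℤ; +_; -_; _+_; _-_; _*_; ∣_∣)
  import Data.Integer.Properties as ℤ
  import Data.Integer.Divisibility.Signed as Signed
  open Signed using (divides; ∣ᵤ⇒∣; ∣⇒∣ᵤ; ∣m∣n⇒∣m+n)
  open import Data.Integer.Tactic.RingSolver using (solve-∀)

  infix 4 _≡_mod_

  -- A record rather than a synonym so that x, y and m can be inferred; its
  -- field is literally the edge condition of IsSpline.
  record _≡_mod_ (x y : ℤ) (m : ℕ) : Set where
    constructor ∣⇒mod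
    field
      mod⇒∣ : m ∣ ∣ x - y ∣

  open _≡_mod_ public

  mod-intro : ∀ {x y m} q → x - y ≡ q * + m → x ≡ y mod m
  mod-intro q eq = ∣⇒mod (∣⇒∣ᵤ (divides q eq))

  mod-refl : ∀ {x m} → x ≡ x mod m
  mod-refl {x} {m} = ∣⇒mod (subst (m ∣_) (sym (cong ∣_∣ (ℤ.+-inverseʳ x))) (m ∣0))

  mod-sym : ∀ {x y m} → x ≡ y mod m → y ≡ x mod m
  mod-sym {x} {y} {m} (∣⇒mod m∣x-y) = ∣⇒mod (subst (m ∣_) (ℤ.∣i-j∣≡∣j-i∣ x y) m∣x-y)

  mod-trans : ∀ {x y z m} → x ≡ y mod m → y ≡ z mod m → x ≡ z mod m
  mod-trans {x} {y} {z} {m} (∣⇒mod m∣x-y) (∣⇒mod m∣y-z) = ∣⇒mod (∣⇒∣ᵤ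
    (subst (+ m Signed.∣_) (telescope x y z)
      (∣m∣n⇒∣m+n (∣ᵤ⇒∣ {i = x - y} m∣x-y) (∣ᵤ⇒∣ {i = y - z} m∣y-z))))
    where
    telescope : ∀ x y z → (x - y) + (y - z) ≡ x - z
    telescope = solve-∀

  mod-weaken : ∀ {x y m n} → n ∣ m → x ≡ y mod m → x ≡ y mod n
  mod-weaken n∣m (∣⇒mod m∣x-y) = ∣⇒mod (∣-trans n∣m m∣x-y)

  pos-+-* : ∀ d y n x m → d ℕ.+ y ℕ.* n ≡ x ℕ.* m → + d + + y * + n ≡ + x * + m
  pos-+-* d y n x m eq = begin
    + d + + y * + n      ≡⟨ cong (_+_ (+ d)) (ℤ.pos-* y n) ⟨
    + d + + (y ℕ.* n)    ≡⟨ ℤ.pos-+ d (y ℕ.* n) ⟨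
    + (d ℕ.+ y ℕ.* n)    ≡⟨ cong +_ eq ⟩
    + (x ℕ.* m)          ≡⟨ ℤ.pos-* x m ⟩
    + x * + m            ∎
    where open ≡-Reasoning

  bézout : ∀ m n → ∃₂ λ u v → + gcd m n ≡ u * + m + v * + n
  bézout m n with Bézout.identity (gcd-GCD m n)
  ... | Bézout.+- x y eq =
    + x , - + y , trans (cancel _ (+ y) (+ n)) (cong (_+ - + y * + n) (pos-+-* _ y n x m eq))
    where
    cancel : ∀ g y n → g ≡ (g + y * n) + - y * n
    cancel = solve-∀
  ... | Bézout.-+ x y eq =
    - + x , + y , trans (cancel _ (+ x) (+ m)) (cong (_+_ (- + x * + m)) (pos-+-* _ x m y n eq))
    where
    cancel : ∀ g x m → g ≡ - x * m + (g + x * m)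
    cancel = solve-∀

  -- With u a + v b = gcd a b and c - d = t · gcd a b, take x = c - t u a.
  chinese-remainder₂ : ∀ {a b c d} → c ≡ d mod gcd a b → ∃ λ x → x ≡ c mod a × x ≡ d mod b
  chinese-remainder₂ {a} {b} {c} {d} (∣⇒mod g∣c-d)
    with ∣ᵤ⇒∣ {+ gcd a b} {c - d} g∣c-d | bézout a b
  ... | divides t c-d≡tg | u , v , g≡ua+vb =
    x , mod-intro (- (t * u)) (trans (drop c (t * u * + a)) (neg t u (+ a))) , mod-intro (t * v) x-d≡tvb
    where
    open ≡-Reasoning
    x = c - t * u * + a
    drop : ∀ c w → (c - w) - c ≡ - w
    drop = solve-∀
    neg : ∀ t u a → - (t * u * a) ≡ - (t * u) * a
    neg = solve-∀
    x-d≡tvb : (c - t * u * + a) - d ≡ t * v * + b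
    x-d≡tvb = begin
      (c - t * u * + a) - d                  ≡⟨ swap c d (t * u * + a) ⟩
      (c - d) - t * u * + a                  ≡⟨ cong (_- t * u * + a) c-d≡tg ⟩
      t * + gcd a b - t * u * + a            ≡⟨ cong (λ g → t * g - t * u * + a) g≡ua+vb ⟩
      t * (u * + a + v * + b) - t * u * + a  ≡⟨ expand t u v (+ a) (+ b) ⟩
      t * v * + b                            ∎
      where
      swap : ∀ c d w → (c - w) - d ≡ (c - d) - w
      swap = solve-∀
      expand : ∀ t u v a b → t * (u * a + v * b) - t * u * a ≡ t * v * b
      expand = solve-∀

open Congruence
open import Data.Integer using (ℤ; +_; ∣_∣) renaming (_+_ to _+ℤ_; _*_ to _*ℤ_; _-_ to _-ℤ_)

module _ {ℓ} {A : Set ℓ} (m : A → ℕ) (c : A → ℤ) where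

  Compatible : A → A → Set
  Compatible p q = c p ≡ c q mod gcd (m p) (m q)

  Solves : ℤ → A → Set
  Solves x p = x ≡ c p mod m p

  solvable⇒compatible : ∀ {x xs} → All (Solves x) xs → AllPairs Compatible xs
  solvable⇒compatible = All⇒AllPairs λ {p} {q} x≡cp x≡cq →
    mod-trans (mod-weaken (gcd[m,n]∣m (m p) (m q)) (mod-sym x≡cp))
              (mod-weaken (gcd[m,n]∣n (m p) (m q)) x≡cq)

  chinese-remainder : ∀ {xs} → AllPairs Compatible xs → ∃ λ x → All (Solves x) xs
  chinese-remainder {[]}     []           = + 0 , []
  chinese-remainder {p ∷ ps} (p~ps ∷ ps~) = extend (chinese-remainder ps~)
    where
    L = lcmOf m ps
    extend : (∃ λ x′ → All (Solves x′) ps) → ∃ λ x → All (Solves x) (p ∷ ps)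
    extend (x′ , x′-solves) =
      let x , x≡cp , x≡x′ = chinese-remainder₂ {m p} {L} cp≡x′ in
      x , x≡cp ∷ All.zipWith (λ (mq∣L , x′≡cq) → mod-trans (mod-weaken mq∣L x≡x′) x′≡cq)
                             (m∣lcmOf m ps , x′-solves)
      where
      cp≡x′ : c p ≡ x′ mod gcd (m p) L
      cp≡x′ = ∣⇒mod (gcd-lcmOf-least m (m p) ps (All.zipWith
        (λ {q} (cp≡cq , x′≡cq) →
           mod⇒∣ (mod-trans cp≡cq (mod-sym (mod-weaken (gcd[m,n]∣n (m p) (m q)) x′≡cq))))
        (p~ps , x′-solves)))

module _ {N : ℕ} where

  SplineEdge : (Fin N → ℤ) → Edge N → Set
  SplineEdge g e = g (src e) ≡ g (tgt e) mod wt e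

  Spline : List (Edge N) → (Fin N → ℤ) → Set
  Spline es g = All (SplineEdge g) es

  IsSpline⇒Spline : ∀ {es g} → IsSpline es g → Spline es g
  IsSpline⇒Spline = All.map ∣⇒mod

  Spline⇒IsSpline : ∀ {es g} → Spline es g → IsSpline es g
  Spline⇒IsSpline = All.map mod⇒∣

  record LiveEdge (al : Fin N → Bool) (e : Edge N) : Set where
    constructor live
    field
      src-alive : al (src e) ≡ true
      tgt-alive : al (tgt e) ≡ true
      src≢tgt   : src e ≢ tgt e

  Live : State N → Set
  Live s = All (LiveEdge (alive s)) (edges s)

  incident⇒joins : ∀ {v} (e : Edge N) → T (incidentᵇ v e) → Joins v (other v e) e
  incident⇒joins {v} (x , y , a) inc with x ≟ v | y ≟ v
  ... | yes refl | _        = inj₁ (refl , refl)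
  ... | no _     | yes refl = inj₂ (refl , refl)

  ¬incident⇒≢ : ∀ {v} (e : Edge N) → T (not (incidentᵇ v e)) → src e ≢ v × tgt e ≢ v
  ¬incident⇒≢ {v} (x , y , a) ¬inc with x ≟ v | y ≟ v
  ... | no x≢v | no y≢v = x≢v , y≢v

  SplineEdge⇒≡ : ∀ g {u w} {e : Edge N} → Joins u w e → SplineEdge g e → g u ≡ g w mod wt e
  SplineEdge⇒≡ g (inj₁ (refl , refl)) gu≡gw = gu≡gw
  SplineEdge⇒≡ g (inj₂ (refl , refl)) gw≡gu = mod-sym gw≡gu

  ≡⇒SplineEdge : ∀ g {u w} {e : Edge N} → Joins u w e → g u ≡ g w mod wt e → SplineEdge g e
  ≡⇒SplineEdge g (inj₁ (refl , refl)) gu≡gw = gu≡gw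
  ≡⇒SplineEdge g (inj₂ (refl , refl)) gu≡gw = mod-sym gu≡gw

  joins-live : ∀ {al u w a} {e : Edge N} → Joins u w e → LiveEdge al e → LiveEdge al (u , w , a)
  joins-live (inj₁ (refl , refl)) (live s-alive t-alive s≢t) = live s-alive t-alive s≢t
  joins-live (inj₂ (refl , refl)) (live s-alive t-alive s≢t) = live t-alive s-alive (s≢t ∘ sym)

  joins⇒samePair : ∀ {u w} {e f : Edge N} → Joins u w e → Joins u w f → SamePair e f
  joins⇒samePair (inj₁ (refl , refl)) f-joins = f-joins
  joins⇒samePair (inj₂ (refl , refl)) (inj₁ f≡) = inj₂ f≡
  joins⇒samePair (inj₂ (refl , refl)) (inj₂ f≡) = inj₁ f≡

  update-incident : ∀ {g v w x} {e : Edge N} → Joins v w e → x ≡ g w mod wt e →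
                    SplineEdge (updateAt g v (const x)) e
  update-incident {g} {v} {w} {x} j x≡gw with w ≟ v
  ... | yes refl = ≡⇒SplineEdge (updateAt g v (const x)) j mod-refl
  ... | no w≢v   = ≡⇒SplineEdge (updateAt g v (const x)) j
    (subst₂ (_≡_mod _) (sym (updateAt-updates v g)) (sym (updateAt-minimal w v g w≢v)) x≡gw)

  update-far : ∀ {g v x} {e : Edge N} → src e ≢ v × tgt e ≢ v → SplineEdge g e →
               SplineEdge (updateAt g v (const x)) e
  update-far {g} {v} {e = e} (s≢v , t≢v) =
    subst₂ (_≡_mod _) (sym (updateAt-minimal (src e) v g s≢v)) (sym (updateAt-minimal (tgt e) v g t≢v))

  starClique-alive : ∀ (s : State N) {u v} → u ≢ v → alive (starClique s v) u ≡ alive s u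
  starClique-alive s {u} {v} u≢v with u ≟ v
  ... | yes u≡v = contradiction u≡v u≢v
  ... | no _    = refl

  starClique-removes : ∀ (s : State N) {u v} → alive (starClique s v) u ≡ true → u ≢ v
  starClique-removes s {u} {v} u-alive with u ≟ v
  starClique-removes s ()      | yes _
  starClique-removes s u-alive | no u≢v = u≢v

  cliqueEdge : Fin N → Edge N → Edge N → Edge N
  cliqueEdge v e f = other v e , other v f , gcd (wt e) (wt f)

  clique⁺ : ∀ {p} {P : Edge N → Set p} v fs →
            AllPairs (λ e f → P (cliqueEdge v e f)) fs → All P (clique v fs)
  clique⁺ v []       []            = []
  clique⁺ v (e ∷ fs) (e~fs ∷ fs~) = AllP.++⁺ (AllP.map⁺ e~fs) (clique⁺ v fs fs~)

  clique⁻ : ∀ {p} {P : Edge N → Set p} v fs →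
            All P (clique v fs) → AllPairs (λ e f → P (cliqueEdge v e f)) fs
  clique⁻ v []       _  = []
  clique⁻ v (e ∷ fs) ps with AllP.++⁻ (map (cliqueEdge v e) fs) ps
  ... | e~fs , fs~ = AllP.map⁻ e~fs ∷ clique⁻ v fs fs~

  cliqueEdge-live : ∀ (s : State N) {v} {e f : Edge N} →
                    Joins v (other v e) e × LiveEdge (alive s) e →
                    Joins v (other v f) f × LiveEdge (alive s) f →
                    ¬ SamePair e f → LiveEdge (alive (starClique s v)) (cliqueEdge v e f)
  cliqueEdge-live s {v} {e} {f} (je , le) (jf , lf) ¬same
    with joins-live {a = 0} je le | joins-live {a = 0} jf lf
  ... | live _ we-alive v≢we | live _ wf-alive v≢wf = live
    (trans (starClique-alive s (v≢we ∘ sym)) we-alive)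
    (trans (starClique-alive s (v≢wf ∘ sym)) wf-alive)
    λ we≡wf → ¬same (joins⇒samePair {v} {other v e} {e} {f} je
                                    (subst (λ w → Joins v w f) (sym we≡wf) jf))

  module _ (s : State N) (v : Fin N) where

    private
      incident = filterᵇ (incidentᵇ v) (edges s)
      far      = filterᵇ (not ∘ incidentᵇ v) (edges s)

      all-incident : All (T ∘ incidentᵇ v) incident
      all-incident = AllP.all-filter (T? ∘ incidentᵇ v) (edges s)

      all-far : All (T ∘ not ∘ incidentᵇ v) far
      all-far = AllP.all-filter (T? ∘ not ∘ incidentᵇ v) (edges s)

    star-spline : ∀ {g} → Spline (edges s) g → Spline (edges (starClique s v)) g
    star-spline {g} sp = AllP.++⁺ (AllP.filter⁺ _ sp) (clique⁺ v incident
      (solvable⇒compatible wt (g ∘ other v) (All.zipWith gv≡ (all-incident , AllP.filter⁺ _ sp))))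
      where
      gv≡ : ∀ {e} → T (incidentᵇ v e) × SplineEdge g e → g v ≡ g (other v e) mod wt e
      gv≡ {e} (inc , sp-e) = SplineEdge⇒≡ g (incident⇒joins e inc) sp-e

    star-lift : ∀ {g} → Spline (edges (starClique s v)) g →
                ∃ λ x → Spline (edges s) (updateAt g v (const x))
    star-lift {g} sp with AllP.++⁻ far sp
    ... | sp-far , sp-clique with chinese-remainder wt (g ∘ other v) (clique⁻ v incident sp-clique)
    ... | x , x-solves = x , filterᵇ⁻ (incidentᵇ v) (edges s)
      (All.zipWith (λ {e} (inc , x≡) → update-incident (incident⇒joins e inc) x≡) (all-incident , x-solves))
      (All.zipWith (λ {e} (¬inc , sp-e) → update-far (¬incident⇒≢ e ¬inc) sp-e) (all-far , sp-far))

    star-live : NoMultiple (edges s) → Live s → Live (starClique s v)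
    star-live nm s-live = AllP.++⁺
      (All.zipWith (λ {e} (¬inc , le) → far-live (¬incident⇒≢ e ¬inc) le) (all-far , AllP.filter⁺ _ s-live))
      (clique⁺ v incident (AllPairs.zipWith (λ ((je , jf) , ¬same) → cliqueEdge-live s je jf ¬same)
        (All⇒AllPairs _,_ spokes , AllPairsP.filter⁺ _ nm)))
      where
      far-live : ∀ {e : Edge N} → src e ≢ v × tgt e ≢ v → LiveEdge (alive s) e →
                 LiveEdge (alive (starClique s v)) e
      far-live (s≢v , t≢v) (live s-alive t-alive s≢t) =
        live (trans (starClique-alive s s≢v) s-alive) (trans (starClique-alive s t≢v) t-alive) s≢t
      spokes : All (λ e → Joins v (other v e) e × LiveEdge (alive s) e) incident
      spokes = All.zipWith (λ {e} (inc , le) → incident⇒joins e inc , le) (all-incident , AllP.filter⁺ _ s-live)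

  loopless⇒live : ∀ {es} → Loopless es → Live ⟨ (λ _ → true) , es ⟩
  loopless⇒live = All.map (live refl refl)

  AgreeOn : (Fin N → Bool) → (Fin N → ℤ) → (Fin N → ℤ) → Set
  AgreeOn al g g′ = ∀ i → al i ≡ true → g′ i ≡ g i

  step-spline : ∀ {s t : State N} {g} → Step s t → Spline (edges s) g → Spline (edges t) g
  step-spline (star s v _ _) = star-spline s v
  step-spline {g = g} (collapse al es es₁ rest u w es↭ _ joins) sp
    with AllP.++⁻ es₁ (All-resp-↭ es↭ sp)
  ... | sp₁ , sp-rest = ∣⇒mod (lcmOf-least wt es₁ (All.zipWith wt∣gu-gw (joins , sp₁))) ∷ sp-rest
    where
    wt∣gu-gw : ∀ {e} → Joins u w e × SplineEdge g e → wt e ∣ ∣ g u -ℤ g w ∣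
    wt∣gu-gw (j , sp-e) = mod⇒∣ (SplineEdge⇒≡ g j sp-e)

  step-lift : ∀ {s t : State N} {g} → Step s t → Spline (edges t) g →
              ∃ λ g′ → Spline (edges s) g′ × AgreeOn (alive t) g g′
  step-lift {g = g} (star s v _ _) sp with star-lift s v sp
  ... | x , sp′ =
    updateAt g v (const x) , sp′ , λ i i-alive → updateAt-minimal i v g (starClique-removes s i-alive)
  step-lift {g = g} (collapse al es es₁ rest u w es↭ _ joins) (gu≡gw ∷ sp-rest) =
    g , All-resp-↭ (↭-sym es↭) (AllP.++⁺ (All.zipWith lift-edge (joins , m∣lcmOf wt es₁)) sp-rest) ,
    λ _ _ → refl
    where
    lift-edge : ∀ {e} → Joins u w e × wt e ∣ lcmList es₁ → SplineEdge g e
    lift-edge (j , wt∣lcm) = ≡⇒SplineEdge g j (mod-weaken wt∣lcm gu≡gw)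

  step-live : ∀ {s t : State N} → Step s t → Live s → Live t
  step-live (star s v _ nm) = star-live s v nm
  step-live (collapse al es (e ∷ es₁) rest u w es↭ _ (j ∷ _)) s-live
    with AllP.++⁻ (e ∷ es₁) (All-resp-↭ es↭ s-live)
  ... | le ∷ _ , live-rest = joins-live j le ∷ live-rest

  step-alive⁻ : ∀ {s t : State N} {i} → Step s t → alive t i ≡ true → alive s i ≡ true
  step-alive⁻ (star s v _ _) i-alive = trans (sym (starClique-alive s (starClique-removes s i-alive))) i-alive
  step-alive⁻ (collapse _ _ _ _ _ _ _ _ _) i-alive = i-alive

  steps-spline : ∀ {s t : State N} {g} → Steps s t → Spline (edges s) g → Spline (edges t) g
  steps-spline ε          = id
  steps-spline (st ◅ sts) = steps-spline sts ∘ step-spline st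

  steps-live : ∀ {s t : State N} → Steps s t → Live s → Live t
  steps-live ε          = id
  steps-live (st ◅ sts) = steps-live sts ∘ step-live st

  steps-alive⁻ : ∀ {s t : State N} {i} → Steps s t → alive t i ≡ true → alive s i ≡ true
  steps-alive⁻ ε          = id
  steps-alive⁻ (st ◅ sts) = step-alive⁻ st ∘ steps-alive⁻ sts

  steps-lift : ∀ {s t : State N} {g} → Steps s t → Spline (edges t) g →
               ∃ λ g′ → Spline (edges s) g′ × AgreeOn (alive t) g g′
  steps-lift {g = g} ε sp = g , sp , λ _ _ → refl
  steps-lift (st ◅ sts) sp with steps-lift sts sp
  ... | g₁ , sp₁ , agree₁ with step-lift st sp₁
  ... | g′ , sp′ , agree′ =
    g′ , sp′ , λ i i-alive → trans (agree′ i (steps-alive⁻ sts i-alive)) (agree₁ i i-alive)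

open import Data.Nat using (_+_; _≤_; _<_; _<ᵇ_)
open import Data.Fin using (toℕ; _↑ˡ_; fromℕ<)
open import Data.Fin.Properties
  using (toℕ-↑ˡ; toℕ<n; splitAt-<; splitAt⁻¹-↑ˡ; toℕ-injective; toℕ-inject; toℕ-fromℕ<;
         all?; ¬∀⟶∃¬-smallest)
open import Data.Vec.Functional using (_++_)
open import Data.Vec.Functional.Properties using (lookup-++-<; lookup-++ˡ)
open import Data.Bool.Properties using (T-≡)
open import Function.Bundles using (_⇔_; mk⇔; Equivalence)
import Data.Integer.Properties as ℤ

toℕ-↑ˡ< : ∀ {r} k (i : Fin r) → toℕ (i ↑ˡ k) < r
toℕ-↑ˡ< {r} k i = subst (_< r) (sym (toℕ-↑ˡ i k)) (toℕ<n i)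

fromℕ<-↑ˡ : ∀ {r} k (j : Fin (r + k)) (j<r : toℕ j < r) → fromℕ< j<r ↑ˡ k ≡ j
fromℕ<-↑ˡ {r} k j j<r = splitAt⁻¹-↑ˡ (splitAt-< r j j<r)

Spline⇒IsSpline' : ∀ r k {es} {g : Fin (r + k) → ℤ} → Spline es g → IsSpline' r k es (φ r k g)
Spline⇒IsSpline' r k {g = g} = All.map λ {e} sp-e i j i≡ j≡ →
  mod⇒∣ (subst₂ (λ a b → g a ≡ g b mod wt e) (sym i≡) (sym j≡) sp-e)

IsSpline'⇒Spline : ∀ r k {es} {h : Fin r → ℤ} →
                     All (λ e → toℕ (src e) < r × toℕ (tgt e) < r) es →
                     IsSpline' r k es h → Spline es (h ++ const (+ 0))
IsSpline'⇒Spline r k {h = h} below sp′ = All.zipWith extend (below , sp′)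
  where
  extend : ∀ {e} → (toℕ (src e) < r × toℕ (tgt e) < r) × _ → SplineEdge (h ++ const (+ 0)) e
  extend {e} ((s<r , t<r) , sp′-e) =
    subst₂ (_≡_mod wt e) (sym (lookup-++-< h _ (src e) s<r)) (sym (lookup-++-< h _ (tgt e) t<r))
      (∣⇒mod (sp′-e _ _ (fromℕ<-↑ˡ k (src e) s<r) (fromℕ<-↑ˡ k (tgt e) t<r)))

φ-spline : ∀ r k {es} {s′ : State (r + k)} → Steps ⟨ (λ _ → true) , es ⟩ s′ →
           ∀ g → IsSpline es g → IsSpline' r k (edges s′) (φ r k g)
φ-spline r k steps g sp = Spline⇒IsSpline' r k (steps-spline {g = g} steps (IsSpline⇒Spline sp))

φ-surjective : ∀ r k {es} {s′ : State (r + k)} →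
               Loopless es → Steps ⟨ (λ _ → true) , es ⟩ s′ →
               (∀ i → alive s′ i ≡ (toℕ i <ᵇ r)) →
               ∀ h → IsSpline' r k (edges s′) h → ∃ λ g → IsSpline es g × ∀ i → φ r k g i ≡ h i
φ-surjective r k {s′ = s′} loopless st alive≡ h sp′
  with steps-lift st (IsSpline'⇒Spline r k (All.map below (steps-live st (loopless⇒live loopless))) sp′)
  where
  alive⇒< : ∀ {i} → alive s′ i ≡ true → toℕ i < r
  alive⇒< {i} i-alive = ℕ.<ᵇ⇒< (toℕ i) r (Equivalence.from T-≡ (trans (sym (alive≡ i)) i-alive))
  below : ∀ {e} → LiveEdge (alive s′) e → toℕ (src e) < r × toℕ (tgt e) < r
  below (live s-alive t-alive _) = alive⇒< s-alive , alive⇒< t-alive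
... | g , sp , agree =
  g , Spline⇒IsSpline sp , λ i → trans (agree (i ↑ˡ k) (↑ˡ-alive i)) (lookup-++ˡ h _ i)
  where
  ↑ˡ-alive : ∀ i → alive s′ (i ↑ˡ k) ≡ true
  ↑ˡ-alive i = trans (alive≡ (i ↑ˡ k)) (Equivalence.to T-≡ (ℕ.<⇒<ᵇ (toℕ-↑ˡ< k i)))

module _ {N : ℕ} {es : List (Edge N)} {g : Fin N → ℤ} where

  flowUp-vanishes : ∀ {m} → InFlowUp es m g → ∀ j → toℕ j < m → g j ≡ + 0
  flowUp-vanishes (_ , inj₁ (_ , zero-below , _)) = zero-below
  flowUp-vanishes (_ , inj₂ (_ , all-zero))  j _ = all-zero j

  flowUp-≤ : ∀ {m} → InFlowUp es m g → m ≤ N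
  flowUp-≤ (_ , inj₁ (m<N , _))   = ℕ.<⇒≤ m<N
  flowUp-≤ (_ , inj₂ (refl , _)) = ℕ.≤-refl

  flowUp-≥ : ∀ {r m} → (∀ j → toℕ j < r → g j ≡ + 0) → r ≤ N → InFlowUp es m g → r ≤ m
  flowUp-≥ {r} vanish _ (_ , inj₁ (_ , _ , j , j≡m , gj≢0)) =
    ℕ.≮⇒≥ λ m<r → gj≢0 (vanish j (subst (_< r) (sym j≡m) m<r))
  flowUp-≥ _ r≤N (_ , inj₂ (refl , _)) = r≤N

  flowUp-exists : IsSpline es g → ∃ λ m → InFlowUp es m g
  flowUp-exists sp with all? (λ j → g j ℤ.≟ + 0)
  ... | yes all-zero = N , sp , inj₂ (refl , all-zero)
  ... | no ¬all-zero with ¬∀⟶∃¬-smallest N (λ j → g j ≡ + 0) (λ j → g j ℤ.≟ + 0) ¬all-zero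
  ... | j , gj≢0 , zero-before = toℕ j , sp , inj₁ (toℕ<n j , zero-below , j , refl , gj≢0)
    where
    zero-below : ∀ i → toℕ i < toℕ j → g i ≡ + 0
    zero-below i i<j = subst (λ x → g x ≡ + 0)
      (toℕ-injective (trans (toℕ-inject (fromℕ< i<j)) (toℕ-fromℕ< i<j))) (zero-before (fromℕ< i<j))

φ-kernel : ∀ r k {es} (g : Fin (r + k) → ℤ) → IsSpline es g →
           (∀ i → φ r k g i ≡ + 0) ⇔ ∃ λ m → r ≤ m × m ≤ r + k × InFlowUp es m g
φ-kernel r k {es} g sp = mk⇔ to from
  where
  to : (∀ i → φ r k g i ≡ + 0) → ∃ λ m → r ≤ m × m ≤ r + k × InFlowUp es m g
  to φg≡0 with flowUp-exists sp
  ... | m , in-m = m , flowUp-≥ vanish (ℕ.m≤m+n r k) in-m , flowUp-≤ in-m , in-m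
    where
    vanish : ∀ j → toℕ j < r → g j ≡ + 0
    vanish j j<r = trans (cong g (sym (fromℕ<-↑ˡ k j j<r))) (φg≡0 (fromℕ< j<r))
  from : (∃ λ m → r ≤ m × m ≤ r + k × InFlowUp es m g) → ∀ i → φ r k g i ≡ + 0
  from (m , r≤m , _ , in-m) i = flowUp-vanishes in-m (i ↑ˡ k) (ℕ.<-≤-trans (toℕ-↑ˡ< k i) r≤m)

theorem3p8 : ∀ (r k : ℕ) (es : List (Edge (r + k))) → SimpleWeighted es →
    ∀ (s' : State (r + k)) → Steps ⟨ (λ _ → true) , es ⟩ s' →
    (∀ (i : Fin (r + k)) → alive s' i ≡ (toℕ i <ᵇ r)) →
    NoMultiple (edges s') →
    (∀ (g : Fin (r + k) → ℤ) → IsSpline es g → IsSpline' r k (edges s') (φ r k g))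
    × (∀ (g h : Fin (r + k) → ℤ) (i : Fin r) →
         φ r k (λ j → g j +ℤ h j) i ≡ φ r k g i +ℤ φ r k h i)
    × (∀ (c : ℤ) (g : Fin (r + k) → ℤ) (i : Fin r) →
         φ r k (λ j → c *ℤ g j) i ≡ c *ℤ φ r k g i)
    × (∀ (h : Fin r → ℤ) → IsSpline' r k (edges s') h →
         ∃ (λ (g : Fin (r + k) → ℤ) → IsSpline es g × (∀ (i : Fin r) → φ r k g i ≡ h i)))
    × (∀ (g : Fin (r + k) → ℤ) → IsSpline es g →
         ((∀ (i : Fin r) → φ r k g i ≡ + 0) ⇔
          ∃ (λ (m : ℕ) → r ≤ m × m ≤ r + k × InFlowUp es m g)))
theorem3p8 r k es (loopless , _ , _) s' steps alive≡ _ =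
  φ-spline r k steps ,
  (λ _ _ _ → refl) ,
  (λ _ _ _ → refl) ,
  φ-surjective r k loopless steps alive≡ ,
  φ-kernel r k
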